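{- Let $G=(S\cup K,E)$ be a split graph, where $S$ is an independent set and $K$ is a clique of $G$, and assume $K$ is a maximum clique of $G$, i.e. $\omega(G)=|K|$. Then $\omega(G)\le D(G)\le \omega(G)+1$.
   Context: All graphs are finite and simple. A split graph is a graph whose vertex set can be partitioned into an independent set $S$ and a clique $K$. $\omega(G)$ is the clique number. For disjoint vertex sets $A,B$, $A$ dominates $B$ if every vertex of $B$ is adjacent to at least one vertex of $A$. An upper domatic partition of size $k$ is a partition of $V(G)$ into $k$ nonempty parts $V_1,\dots,V_k$ such that for all $1\le i<j\le k$, $V_i$ dominates $V_j$ or $V_j$ dominates $V_i$ (or both); the upper domatic number $D(G)$ is the maximum such $k$. -}

module Defs where

open import Data.Nat using (ℕ; _≤_)
open import Data.Bool using (Bool; true; false)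
open import Data.Fin using (Fin)
open import Data.Fin.Subset using (Subset; _∈_; _∉_; ∣_∣)
open import Data.Product using (Σ; ∃; _×_)
open import Data.Sum using (_⊎_)
open import Relation.Binary.PropositionalEquality using (_≡_; _≢_)
open import Relation.Nullary using (¬_)

record Graph (n : ℕ) : Set where
  field
    adj   : Fin n → Fin n → Bool
    sym   : ∀ u v → adj u v ≡ adj v u
    irrefl : ∀ v → adj v v ≡ false
open Graph public

Adj : ∀ {n} → Graph n → Fin n → Fin n → Set
Adj G u v = adj G u v ≡ true

IsClique : ∀ {n} → Graph n → Subset n → Set
IsClique G C = ∀ u v → u ∈ C → v ∈ C → u ≢ v → Adj G u v

IsIndependent : ∀ {n} → Graph n → Subset n → Set
IsIndependent G I = ∀ u v → u ∈ I → v ∈ I → ¬ Adj G u v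

IsMaximumClique : ∀ {n} → Graph n → Subset n → Set
IsMaximumClique G K = IsClique G K × (∀ C → IsClique G C → ∣ C ∣ ≤ ∣ K ∣)

-- G is split with partition (S, K) where K is the clique and
-- S = V \ K (the vertices not in K) is independent.
IsSplitPartition : ∀ {n} → Graph n → Subset n → Set
IsSplitPartition G K =
  IsClique G K × (∀ u v → u ∉ K → v ∉ K → ¬ Adj G u v)

Dominates : ∀ {n k} → Graph n → (Fin n → Fin k) → Fin k → Fin k → Set
Dominates G p i j = ∀ v → p v ≡ j → ∃ λ u → p u ≡ i × Adj G u v

IsUpperDomaticPartition : ∀ {n} → Graph n → (k : ℕ) → (Fin n → Fin k) → Set
IsUpperDomaticPartition G k p =
  (∀ i → ∃ λ v → p v ≡ i) ×
  (∀ i j → i ≢ j → Dominates G p i j ⊎ Dominates G p j i)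

HasUpperDomaticPartition : ∀ {n} → Graph n → ℕ → Set
HasUpperDomaticPartition G k = ∃ λ p → IsUpperDomaticPartition G k p

{-# OPTIONS --safe #-}
-- Lower bound: give every vertex of the clique K its own part and add the
-- independent set S to one of them.  A part consisting of a single clique
-- vertex is dominated by every other part, since each part contains a clique
-- vertex.  Maximality of K only serves to rule out K = ∅ on a nonempty graph.
--
-- Upper bound: a part avoiding K lies inside the independent set S, so it
-- neither dominates nor is dominated by another such part; hence at most one
-- part avoids K, and the remaining parts contain pairwise distinct vertices
-- of K.
module Submission where

open import Defs hiding (sym)
open import Data.Nat using (zero; suc; _≤_; _<_)
open import Data.Nat.Properties using (≤-refl)
open import Data.Fin using (Fin; zero; suc; _≟_; fromℕ<)
open import Data.Fin.Properties using (any?; injective⇒≤; suc-injective)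
open import Data.Fin.Subset using (Subset; inside; outside; _∈_; ∁; ⁅_⁆; ∣_∣)
open import Data.Fin.Subset.Properties
  using (_∈?_; x∈⁅y⁆⇒x≡y; ∣⁅x⁆∣≡1; ∣p∣≤n; x∉p⇒x∈∁p; x∈∁p⇒x∉p)
open import Data.Vec using (_∷_; here; there)
open import Data.Product using (∃; _×_; _,_; proj₁; proj₂)
open import Data.Sum using (_⊎_; inj₁; inj₂; [_,_])
open import Data.Empty using (⊥-elim)
open import Function using (_∘_)
open import Relation.Nullary using (¬_; Dec; yes; no; contradiction)
open import Relation.Nullary.Decidable using (_×-dec_)
open import Relation.Binary.PropositionalEquality
  using (_≡_; _≢_; refl; sym; trans; cong; subst; module ≡-Reasoning)

element : ∀ {n} (p : Subset n) → Fin ∣ p ∣ → Fin n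
element (inside  ∷ p) zero    = zero
element (inside  ∷ p) (suc i) = suc (element p i)
element (outside ∷ p) i       = suc (element p i)

element∈ : ∀ {n} (p : Subset n) (i : Fin ∣ p ∣) → element p i ∈ p
element∈ (inside  ∷ p) zero    = here
element∈ (inside  ∷ p) (suc i) = there (element∈ p i)
element∈ (outside ∷ p) i       = there (element∈ p i)

index : ∀ {n} (p : Subset n) {x : Fin n} → x ∈ p → Fin ∣ p ∣
index (inside  ∷ p) here        = zero
index (inside  ∷ p) (there x∈p) = suc (index p x∈p)
index (outside ∷ p) (there x∈p) = index p x∈p

element-index : ∀ {n} (p : Subset n) {x : Fin n} (x∈p : x ∈ p) →
                element p (index p x∈p) ≡ x
element-index (inside  ∷ p) here        = refl
element-index (inside  ∷ p) (there x∈p) = cong suc (element-index p x∈p)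
element-index (outside ∷ p) (there x∈p) = cong suc (element-index p x∈p)

index-element : ∀ {n} (p : Subset n) {i : Fin ∣ p ∣} (x∈p : element p i ∈ p) →
                index p x∈p ≡ i
index-element (inside  ∷ p) {zero}  here        = refl
index-element (inside  ∷ p) {suc i} (there x∈p) = cong suc (index-element p x∈p)
index-element (outside ∷ p) {i}     (there x∈p) = index-element p x∈p

index-injective : ∀ {n} (p : Subset n) {x y : Fin n} (x∈p : x ∈ p) (y∈p : y ∈ p) →
                  index p x∈p ≡ index p y∈p → x ≡ y
index-injective p {x} {y} x∈p y∈p eq = begin
  x                       ≡⟨ sym (element-index p x∈p) ⟩
  element p (index p x∈p) ≡⟨ cong (element p) eq ⟩
  element p (index p y∈p) ≡⟨ element-index p y∈p ⟩
  y                       ∎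
  where open ≡-Reasoning

⁅⁆-isClique : ∀ {n} (G : Graph n) (v : Fin n) → IsClique G ⁅ v ⁆
⁅⁆-isClique G v u w u∈⁅v⁆ w∈⁅v⁆ u≢w =
  contradiction (trans (x∈⁅y⁆⇒x≡y v u∈⁅v⁆) (sym (x∈⁅y⁆⇒x≡y v w∈⁅v⁆))) u≢w

maximumClique-nonempty : ∀ {n} (G : Graph n) {K : Subset n} →
                         IsMaximumClique G K → Fin n → 0 < ∣ K ∣
maximumClique-nonempty G {K} (_ , K-maximum) v =
  subst (_≤ ∣ K ∣) (∣⁅x⁆∣≡1 v) (K-maximum ⁅ v ⁆ (⁅⁆-isClique G v))

module CliquePartition {n} (G : Graph n) {K : Subset n} (K-clique : IsClique G K)
                       (default : Fin ∣ K ∣) where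

  part : Fin n → Fin ∣ K ∣
  part v with v ∈? K
  ... | yes v∈K = index K v∈K
  ... | no  _   = default

  part-element : ∀ i → part (element K i) ≡ i
  part-element i with element K i ∈? K
  ... | yes x∈K = index-element K x∈K
  ... | no  x∉K = contradiction (element∈ K i) x∉K

  ∈-nondefault : ∀ v → part v ≢ default → v ∈ K
  ∈-nondefault v pv≢default with v ∈? K
  ... | yes v∈K = v∈K
  ... | no  _   = contradiction refl pv≢default

  dominates-nondefault : ∀ {i j} → i ≢ j → j ≢ default → Dominates G part i j
  dominates-nondefault {i} {j} i≢j j≢default v pv≡j =
    element K i , part-element i ,
    K-clique _ v (element∈ K i) (∈-nondefault v (j≢default ∘ trans (sym pv≡j))) x≢v
    where
    x≢v : element K i ≢ v
    x≢v x≡v = i≢j (trans (sym (part-element i)) (trans (cong part x≡v) pv≡j))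

  isUpperDomaticPartition : IsUpperDomaticPartition G ∣ K ∣ part
  isUpperDomaticPartition = (λ i → element K i , part-element i) , comparable
    where
    comparable : ∀ i j → i ≢ j → Dominates G part i j ⊎ Dominates G part j i
    comparable i j i≢j with j ≟ default
    ... | no  j≢default = inj₁ (dominates-nondefault i≢j j≢default)
    ... | yes refl      = inj₂ (dominates-nondefault (i≢j ∘ sym) i≢j)

maximumClique-upperDomaticPartition :
  ∀ {n} (G : Graph n) {K : Subset n} → IsMaximumClique G K →
  ∃ λ k → ∣ K ∣ ≤ k × HasUpperDomaticPartition G k
maximumClique-upperDomaticPartition {zero} G {K} _ =
  0 , ∣p∣≤n K , (λ ()) , (λ ()) , (λ ())
maximumClique-upperDomaticPartition {suc _} G {K} K-max@(K-clique , _) =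
  ∣ K ∣ , ≤-refl , part , isUpperDomaticPartition
  where open CliquePartition G K-clique (fromℕ< (maximumClique-nonempty G K-max zero))

module _ {n k} (G : Graph n) (K : Subset n) (S-independent : IsIndependent G (∁ K))
         (p : Fin n → Fin k) (udp : IsUpperDomaticPartition G k p)
         where

  MeetsK : Fin k → Set
  MeetsK i = ∃ λ v → v ∈ K × p v ≡ i

  meetsK? : ∀ i → Dec (MeetsK i)
  meetsK? i = any? λ v → (v ∈? K) ×-dec (p v ≟ i)

  avoidsK-¬dominates : ∀ {i j} → ¬ MeetsK i → ¬ MeetsK j → ¬ Dominates G p i j
  avoidsK-¬dominates {i} {j} i-avoids j-avoids dominates with proj₁ udp j
  ... | v , pv≡j with dominates v pv≡j
  ... | u , pu≡i , u~v =
    S-independent u v (outside-K i-avoids pu≡i) (outside-K j-avoids pv≡j) u~v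
    where
    outside-K : ∀ {w l} → ¬ MeetsK l → p w ≡ l → w ∈ ∁ K
    outside-K l-avoids pw≡l = x∉p⇒x∈∁p λ w∈K → l-avoids (_ , w∈K , pw≡l)

  avoidsK-unique : ∀ {i j} → ¬ MeetsK i → ¬ MeetsK j → i ≡ j
  avoidsK-unique {i} {j} i-avoids j-avoids with i ≟ j
  ... | yes i≡j = i≡j
  ... | no  i≢j = ⊥-elim ([ avoidsK-¬dominates i-avoids j-avoids
                          , avoidsK-¬dominates j-avoids i-avoids
                          ] (proj₂ udp i j i≢j))

  label : ∀ {i} → Dec (MeetsK i) → Fin (suc ∣ K ∣)
  label (yes (_ , v∈K , _)) = suc (index K v∈K)
  label (no _)              = zero

  label-injective : ∀ {i j} (i? : Dec (MeetsK i)) (j? : Dec (MeetsK j)) →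
                    label i? ≡ label j? → i ≡ j
  label-injective (yes (u , u∈K , pu≡i)) (yes (v , v∈K , pv≡j)) eq =
    trans (sym pu≡i) (trans (cong p (index-injective K u∈K v∈K (suc-injective eq))) pv≡j)
  label-injective (yes _) (no _) ()
  label-injective (no _) (yes _) ()
  label-injective (no i-avoids) (no j-avoids) _ = avoidsK-unique i-avoids j-avoids

  upperDomaticPartition-size≤ : k ≤ suc ∣ K ∣
  upperDomaticPartition-size≤ =
    injective⇒≤ {f = label ∘ meetsK?} (label-injective (meetsK? _) (meetsK? _))

splitPartition-complement-independent : ∀ {n} (G : Graph n) {K : Subset n} →
                                        IsSplitPartition G K → IsIndependent G (∁ K)
splitPartition-complement-independent G (_ , S-independent) u v u∈S v∈S =
  S-independent u v (x∈∁p⇒x∉p u∈S) (x∈∁p⇒x∉p v∈S)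

lemma5 : ∀ {n} (G : Graph n) (K : Subset n) →
         IsSplitPartition G K → IsMaximumClique G K →
         (∃ λ k → ∣ K ∣ ≤ k × HasUpperDomaticPartition G k) ×
         (∀ k → HasUpperDomaticPartition G k → k ≤ suc ∣ K ∣)
lemma5 G K split K-max =
    maximumClique-upperDomaticPartition G K-max
  , λ k (p , udp) → upperDomaticPartition-size≤ G K
                      (splitPartition-complement-independent G split) p udp
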